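{- Let $\mathcal{N}$ be a $\oplus$-BAC Chain of length $m\ge 2$ with $n$ automata. If $\mathcal{N}$ is positive, then in the asynchronous mode: if $m-1\not\equiv 0 \pmod 3$, $\mathcal{N}$ has the unique fixed point $0^n$; if $m-1\equiv0\pmod 3$, $\mathcal{N}$ has exactly two fixed points, $0^n$ and the configuration in which the intersection automata $(o_1,\dots,o_{m-1})$ have states given by the word $(101)^{(m-1)/3}$ and every non-intersection automaton has the state of the intersection automaton at the start of its maximal incoming nude path. If $\mathcal{N}$ is negative and $m\equiv1\pmod 3$, then $\mathcal{N}$ has no fixed point.
   Context: A $\oplus$-BAC Chain of length $m$ consists of directed simple cycles $\mathcal{C}_1,\dots,\mathcal{C}_m$ (possibly self-loops) and distinct intersection automata $o_1,\dots,o_{m-1}$ with $\mathcal{C}_k\cap\mathcal{C}_{k+1}=\{o_k\}$, non-consecutive cycles disjoint, every automaton on some cycle; writing $\mathcal{C}_k=(i^k_1,\dots,i^k_{n_k})$ (arcs $i^k_{j-1}\to i^k_j$ and $i^k_{n_k}\to i^k_1$), $o_k=i^k_1=i^{k+1}_{\ell_k}$. Each non-intersection automaton $i$ has $f_i(x)=\sigma_i(x_p)$ with $p$ its cycle predecessor; each $o_k$ has $f_{o_k}(x)=\sigma(x_p)\oplus\sigma'(x_{p'})$ with $p,p'$ its predecessors on $\mathcal{C}_k$, $\mathcal{C}_{k+1}$; each $\sigma$ is identity or negation. The chain is positive if all literals are positive, and negative if all literals are positive except, in $f_{o_1}$, the literal of the predecessor of $o_1$ on $\mathcal{C}_1$,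 which is negated. A nude path is a path $i_0i_1\cdots i_k$ of distinct automata in which $i_{j-1}$ is the unique influencer of $i_j$ for each $j\ge1$; for a non-intersection automaton, its maximal incoming nude path starts at an intersection automaton. A fixed point is a configuration $x$ with $f_i(x)=x_i$ for all $i$. -}

module Defs where

open import Data.Nat using (ℕ; zero; suc; _<_; _%_)
open import Data.Fin using (Fin; zero; suc; toℕ; inject₁; fromℕ)
open import Data.Bool using (Bool; true; false; not; _xor_)
open import Data.List using (List; []; _∷_; _∷ʳ_)
open import Data.List.Relation.Unary.Unique.Propositional using (Unique)
open import Data.List.Relation.Unary.Linked using (Linked)
open import Data.Product using (Σ; ∃; ∃₂; _×_; _,_)
open import Data.Sum using (_⊎_)
open import Relation.Binary.PropositionalEquality using (_≡_; _≢_)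
open import Relation.Nullary using (¬_)

-- Position of the cycle-predecessor inside a cycle of length (suc s):
-- positions are 0-indexed, position 0 is i^k_1, its predecessor is the last one.
prevIx : ∀ {s} → Fin (suc s) → Fin (suc s)
prevIx {s} zero = fromℕ s
prevIx (suc j) = inject₁ j

-- A ⊕-BAC chain with n automata (Fin n) and m = suc m' cycles
-- C_0 … C_{m'} (0-indexed) and m' intersection automata o_0 … o_{m'-1}.
-- Cycle k is the injective sequence  cyc k 0, …, cyc k (size k)  of automata,
-- with arcs  cyc k (prevIx j) → cyc k j  (size k = 0 is a self-loop).
record Chain (n m' : ℕ) : Set where
  field
    size : Fin (suc m') → ℕ
    cyc : (k : Fin (suc m')) → Fin (suc (size k)) → Fin n
    cyc-simple : ∀ k {j j'} → cyc k j ≡ cyc k j' → j ≡ j'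
  o : Fin m' → Fin n
  o k = cyc (inject₁ k) zero
  field
    o-distinct : ∀ {k k'} → o k ≡ o k' → k ≡ k'
    o-onNext : ∀ k → ∃ λ ℓ → cyc (suc k) ℓ ≡ o k
    consecutive : ∀ k j j' → cyc (inject₁ k) j ≡ cyc (suc k) j' → cyc (inject₁ k) j ≡ o k
    nonConsecutive : ∀ k k' j j' → suc (toℕ k) < toℕ k' → cyc k j ≢ cyc k' j'
    covered : ∀ i → ∃₂ λ k j → cyc k j ≡ i

module _ {n m' : ℕ} (C : Chain n m') where
  open Chain C

  IsIntersection : Fin n → Set
  IsIntersection i = ∃ λ k → o k ≡ i

  Arc : Fin n → Fin n → Set
  Arc a b = ∃₂ λ k j → cyc k (prevIx j) ≡ a × cyc k j ≡ b

  UniqueInfluencer : Fin n → Fin n → Set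
  UniqueInfluencer a b = Arc a b × (∀ a' → Arc a' b → a' ≡ a)

  NudePath : List (Fin n) → Set
  NudePath p = Unique p × Linked UniqueInfluencer p

  MaxIncomingNudeStart : Fin n → Fin n → Set
  MaxIncomingNudeStart i s =
    Σ (List (Fin n)) λ q → NudePath (s ∷ q)
      × (∃ λ r → s ∷ q ≡ r ∷ʳ i)
      × (∀ a → ¬ NudePath (a ∷ s ∷ q))

  -- sign of each literal: sg k j = true iff the literal of cyc k (prevIx j)
  -- in the local function of cyc k j is negated
  Signs : Set
  Signs = (k : Fin (suc m')) → Fin (suc (size k)) → Bool

  lit : Bool → Bool → Bool
  lit b v = b xor v

  IsChainNetwork : Signs → ((Fin n → Bool) → Fin n → Bool) → Set
  IsChainNetwork sg F =
    (∀ x k j → ¬ IsIntersection (cyc k j) →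
       F x (cyc k j) ≡ lit (sg k j) (x (cyc k (prevIx j))))
    × (∀ x k ℓ → cyc (suc k) ℓ ≡ o k →
       F x (o k) ≡ lit (sg (inject₁ k) zero) (x (cyc (inject₁ k) (prevIx zero)))
                   xor lit (sg (suc k) ℓ) (x (cyc (suc k) (prevIx ℓ))))

  Positive : Signs → Set
  Positive sg = ∀ k j → sg k j ≡ false

  isFirstArc : (k : Fin (suc m')) → Fin (suc (size k)) → Bool
  isFirstArc zero zero = true
  isFirstArc _ _ = false

  -- only the literal of the C_1-predecessor of o_1 in f_{o_1} is negated
  Negative : Signs → Set
  Negative sg = ∀ k j → sg k j ≡ isFirstArc k j

  pat101 : ℕ → Bool
  pat101 zero = true
  pat101 (suc zero) = false
  pat101 (suc (suc zero)) = true
  pat101 (suc (suc (suc k))) = pat101 k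

  -- the second fixed point of the positive case
  Special : (Fin n → Bool) → Set
  Special y = (∀ k → y (o k) ≡ pat101 (toℕ k))
    × (∀ i s → ¬ IsIntersection i → MaxIncomingNudeStart i s → y i ≡ y s)

FixedPoint : ∀ {n} → ((Fin n → Bool) → Fin n → Bool) → (Fin n → Bool) → Set
FixedPoint F x = ∀ i → F x i ≡ x i

IsZero : ∀ {n} → (Fin n → Bool) → Set
IsZero x = ∀ i → x i ≡ false

module Submission where

-- Number the intersection automata o₀ … o_M (so m' = M+1) and the cycles C₀ … C_{M+1}.
-- A non-intersection automaton copies its cycle predecessor, so at a fixed point it
-- carries the state of the intersection automaton o_h starting the maximal incoming nude
-- path into it; h = home is computed from its position on its cycle (Geometry).  The two
-- predecessors of o_k then carry the states of o_{k-1} and o_{k+1} (clamped at the ends),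
-- so a configuration is fixed iff it is read off through home from values α on the
-- intersection automata satisfying α(k) = s(k) ⊕ α(k-1) ⊕ α(k+1) (FixedPoints).
-- Padding α with copies of its end values turns these equations into the recurrence
-- D(t+2) = D(t+1) ⊕ D(t) ⊕ s(t), whose solutions are 3-periodic (per3).  With positive
-- literals this forces α = 0 or α = 101101…, the latter consistent at the right end iff
-- 3 ∣ m'; with the single negated literal the forced values clash at the right end when
-- m ≡ 1 (mod 3).

open import Defs
open import Data.Nat using (ℕ; zero; suc; _+_; _∸_; _≤_; _<_; _<?_; _%_; z≤n; s≤s; s≤s⁻¹)
open import Data.Nat.Properties
  using (≤-refl; ≤-trans; ≤-reflexive; ≤-antisym; <-≤-trans; ≤-<-trans; <⇒≤; <⇒≢; >⇒≢; <⇒≱; ≮⇒≥;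
         ≤∧≢⇒<; <-irrefl; n≤1+n; n<1+n; <-trans; 1+n≢n; n≢0⇒n>0; m≤n+m; m∸n+n≡m; suc-injective; <-cmp;
         m≤n⇒m<n∨m≡n; m≤n⇒m≤1+n)
open import Data.Fin using (Fin; zero; suc; toℕ; inject₁; fromℕ)
open import Data.Fin.Properties
  using (toℕ-injective; toℕ-inject₁; toℕ≤pred[n]; toℕ-fromℕ; fromℕ≢inject₁; any?)
  renaming (_≟_ to _≟ᶠ_)
open import Data.Bool using (Bool; true; false; _xor_; if_then_else_)
open import Data.Bool.Properties using (xor-identityʳ; xor-same)
open import Data.List using (List; []; _∷_; _∷ʳ_; _++_)
open import Data.List.Properties using (++-assoc; ∷-injectiveʳ)
open import Data.List.Membership.Propositional using (_∈_)
open import Data.List.Membership.Propositional.Properties using (∈-++⁺ʳ)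
open import Data.List.Relation.Unary.All as All using (All; []; _∷_)
open import Data.List.Relation.Unary.All.Properties using () renaming (++⁺ to all-++⁺)
open import Data.List.Relation.Unary.AllPairs using ([]; _∷_)
open import Data.List.Relation.Unary.Any using (here)
open import Data.List.Relation.Unary.Linked using (Linked; []; [-]; _∷_)
open import Data.List.Relation.Unary.Unique.Propositional.Properties using () renaming (++⁺ to unique-++⁺)
open import Data.List.Relation.Binary.Disjoint.Propositional using (Disjoint)
open import Data.Product using (Σ; ∃; _×_; _,_; proj₁; proj₂)
open import Data.Sum using (_⊎_; inj₁; inj₂; [_,_]; map₂)
open import Data.Empty using (⊥-elim)
open import Function using (_∘_; id)
open import Function.Bundles using (_⇔_; mk⇔; Equivalence)
open import Relation.Binary using (tri<; tri≈; tri>)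
open import Relation.Binary.PropositionalEquality hiding ([_])
open import Relation.Nullary using (¬_; Dec; yes; no; does)
open import Relation.Nullary.Decidable using (dec-true; dec-false)

-- The 3-periodic sequence a, b, b ⊕ a, a, b, b ⊕ a, … ; it is the unique solution of
-- the recurrence u(t+2) = u(t+1) ⊕ u(t) with initial values a, b.
per3 : Bool → Bool → ℕ → Bool
per3 a b zero = a
per3 a b (suc zero) = b
per3 a b (suc (suc zero)) = b xor a
per3 a b (suc (suc (suc t))) = per3 a b t

per3-shift : ∀ a b t → per3 a b (suc t) ≡ per3 b (b xor a) t
per3-shift a b zero = refl
per3-shift a b (suc zero) = refl
per3-shift a b (suc (suc zero)) = xor-swap a b
  where
    xor-swap : ∀ a b → a ≡ (b xor a) xor b
    xor-swap false false = refl
    xor-swap false true = refl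
    xor-swap true false = refl
    xor-swap true true = refl
per3-shift a b (suc (suc (suc t))) = per3-shift a b t

XorRecurrence : (ℕ → Bool) → ℕ → Set
XorRecurrence D N = ∀ (t : Fin N) → D (2 + toℕ t) ≡ D (1 + toℕ t) xor D (toℕ t)

xorRecurrence⇒per3 : ∀ N D → XorRecurrence D N → ∀ t → t ≤ suc N → D t ≡ per3 (D 0) (D 1) t
xorRecurrence⇒per3 N D rec zero _ = refl
xorRecurrence⇒per3 N D rec (suc zero) _ = refl
xorRecurrence⇒per3 zero D rec (suc (suc t)) (s≤s ())
xorRecurrence⇒per3 (suc N) D rec (suc (suc t)) (s≤s t≤N) = begin
  D (2 + t)                           ≡⟨ xorRecurrence⇒per3 N (D ∘ suc) (rec ∘ suc) (suc t) t≤N ⟩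
  per3 (D 1) (D 2) (suc t)            ≡⟨ cong (λ c → per3 (D 1) c (suc t)) (rec zero) ⟩
  per3 (D 1) (D 1 xor D 0) (suc t)    ≡⟨ per3-shift (D 0) (D 1) (suc t) ⟨
  per3 (D 0) (D 1) (2 + t)            ∎
  where open ≡-Reasoning

per3-false : ∀ t → per3 false false t ≡ false
per3-false zero = refl
per3-false (suc zero) = refl
per3-false (suc (suc zero)) = refl
per3-false (suc (suc (suc t))) = per3-false t

per3-middle : ∀ t → per3 true true (suc t) ≡ per3 true true t xor per3 true true (2 + t)
per3-middle zero = refl
per3-middle (suc zero) = refl
per3-middle (suc (suc zero)) = refl
per3-middle (suc (suc (suc t))) = per3-middle t

per3-plateau : ∀ t → (per3 true true (suc t) ≡ per3 true true (2 + t)) ⇔ (suc t % 3 ≡ 0)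
per3-plateau zero = mk⇔ (λ ()) (λ ())
per3-plateau (suc zero) = mk⇔ (λ ()) (λ ())
per3-plateau (suc (suc zero)) = mk⇔ (λ _ → refl) (λ _ → refl)
per3-plateau (suc (suc (suc t))) = per3-plateau t

per3-noPlateau : ∀ a t → suc (suc t) % 3 ≡ 1 → per3 a true (suc t) ≢ per3 a true t
per3-noPlateau a zero ()
per3-noPlateau a (suc zero) ()
per3-noPlateau false (suc (suc zero)) _ ()
per3-noPlateau true (suc (suc zero)) _ ()
per3-noPlateau a (suc (suc (suc t))) t≡2 = per3-noPlateau a t t≡2

down : ∀ {m} → Fin m → Fin m
down zero = zero
down (suc k) = inject₁ k

up : ∀ {m} → Fin (suc m) → Fin (suc m)
up {zero} zero = zero
up {suc m} zero = suc zero
up {suc m} (suc k) = suc (up k)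

up-inject₁ : ∀ {m} (k : Fin m) → up (inject₁ k) ≡ suc k
up-inject₁ zero = refl
up-inject₁ (suc k) = cong suc (up-inject₁ k)

up-last : ∀ m → up (fromℕ m) ≡ fromℕ m
up-last zero = refl
up-last (suc m) = cong suc (up-last m)

data LastView : ∀ {m} → Fin (suc m) → Set where
  inner : ∀ {m} (k : Fin m) → LastView (inject₁ k)
  last : ∀ {m} → LastView (fromℕ m)

lastView : ∀ {m} (k : Fin (suc m)) → LastView k
lastView {zero} zero = last
lastView {suc m} zero = inner zero
lastView {suc m} (suc k) with lastView k
... | inner k′ = inner (suc k′)
... | last = last

-- The balance equations α(k) = s(k) ⊕ α(k-1) ⊕ α(k+1) (neighbours clamped)
-- that the states of the intersection automata satisfy at a fixed point.
IntersectionEqs : ∀ {M} → (Fin (suc M) → Bool) → (Fin (suc M) → Bool) → Set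
IntersectionEqs s α = ∀ k → α k ≡ (s k xor α (down k)) xor α (up k)

clamp : ∀ {m} → ℕ → Fin (suc m)
clamp zero = zero
clamp {zero} (suc t) = zero
clamp {suc m} (suc t) = suc (clamp t)

clamp-toℕ : ∀ {m} (k : Fin (suc m)) → clamp (toℕ k) ≡ k
clamp-toℕ zero = refl
clamp-toℕ {suc m} (suc k) = cong suc (clamp-toℕ k)

clamp-inject₁ : ∀ {m} (k : Fin (suc m)) → clamp (toℕ k) ≡ inject₁ k
clamp-inject₁ zero = refl
clamp-inject₁ {suc m} (suc k) = cong suc (clamp-inject₁ k)

clamp-up : ∀ {m} (k : Fin (suc m)) → clamp (suc (toℕ k)) ≡ up k
clamp-up {zero} zero = refl
clamp-up {suc m} zero = refl
clamp-up {suc m} (suc k) = cong suc (clamp-up k)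

clamp-top : ∀ m → clamp {m} (suc m) ≡ clamp m
clamp-top zero = refl
clamp-top (suc m) = cong suc (clamp-top m)

-- The values α(0), α(0), α(1), …, α(M), α(M): the intersection values padded with
-- copies of the end values, so that down/up become plain index shifts.
extend : ∀ {M} → (Fin (suc M) → Bool) → ℕ → Bool
extend α zero = α zero
extend α (suc t) = α (clamp t)

extend-down : ∀ {M} (α : Fin (suc M) → Bool) k → extend α (toℕ k) ≡ α (down k)
extend-down α zero = refl
extend-down {suc M} α (suc k) = cong α (clamp-inject₁ k)

balanced⇒recurrence : ∀ {M} (s α : Fin (suc M) → Bool) → IntersectionEqs s α → ∀ k →
  extend α (2 + toℕ k) ≡ (extend α (1 + toℕ k) xor extend α (toℕ k)) xor s k
balanced⇒recurrence s α eqs k = begin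
  extend α (2 + toℕ k)                        ≡⟨ cong α (clamp-up k) ⟩
  α (up k)                                    ≡⟨ solve (α k) (s k) (α (down k)) (α (up k)) (eqs k) ⟩
  (α k xor α (down k)) xor s k                ≡⟨ cong₂ (λ u v → (u xor v) xor s k) (cong α (clamp-toℕ k)) (extend-down α k) ⟨
  (extend α (1 + toℕ k) xor extend α (toℕ k)) xor s k ∎
  where
    open ≡-Reasoning
    solve : ∀ a s b c → a ≡ (s xor b) xor c → c ≡ (a xor b) xor s
    solve ._ false false false refl = refl
    solve ._ false false true refl = refl
    solve ._ false true false refl = refl
    solve ._ false true true refl = refl
    solve ._ true false false refl = refl
    solve ._ true false true refl = refl
    solve ._ true true false refl = refl
    solve ._ true true true refl = refl

pattern101 : ∀ {M} → Fin (suc M) → Bool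
pattern101 k = per3 true true (suc (toℕ k))

positive-balanced : ∀ {M} (s α : Fin (suc M) → Bool) → (∀ k → s k ≡ false) → IntersectionEqs s α →
  (∀ k → α k ≡ per3 (α zero) (α zero) (suc (toℕ k))) × (α zero ≡ true → suc M % 3 ≡ 0)
positive-balanced {M} s α positive eqs = values , nonzero⇒divisible
  where
    D : ℕ → Bool
    D = extend α
    homogeneous : XorRecurrence D (suc M)
    homogeneous k = trans (balanced⇒recurrence s α eqs k)
                          (trans (cong ((D (1 + toℕ k) xor D (toℕ k)) xor_) (positive k)) (xor-identityʳ _))
    solution : ∀ t → t ≤ 2 + M → D t ≡ per3 (α zero) (α zero) t
    solution = xorRecurrence⇒per3 (suc M) D homogeneous
    values : ∀ k → α k ≡ per3 (α zero) (α zero) (suc (toℕ k))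
    values k = trans (cong α (sym (clamp-toℕ k)))
                     (solution (suc (toℕ k)) (s≤s (m≤n⇒m≤1+n (toℕ≤pred[n] k))))
    plateau : D (1 + M) ≡ D (2 + M)
    plateau = cong α (sym (clamp-top M))
    nonzero⇒divisible : α zero ≡ true → suc M % 3 ≡ 0
    nonzero⇒divisible α₀ = Equivalence.to (per3-plateau M)
      (subst (λ c → per3 c c (1 + M) ≡ per3 c c (2 + M)) α₀
        (trans (sym (solution (1 + M) (m≤n⇒m≤1+n ≤-refl))) (trans plateau (solution (2 + M) ≤-refl))))

-- With only the literal of the C₁-predecessor of o₁ negated there is no balanced family
-- when M ≡ 2 (mod 3): the forced values α(0), 1, ¬α(0), … clash with the right end.
negative-balanced : ∀ {M} (s α : Fin (suc M) → Bool) → s zero ≡ true → (∀ k → s (suc k) ≡ false) →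
  suc (suc M) % 3 ≡ 1 → ¬ IntersectionEqs s α
negative-balanced {M} s α s₀ sₖ M≡2 eqs = per3-noPlateau (D 0) M M≡2 clash
  where
    D : ℕ → Bool
    D = extend α ∘ suc
    homogeneous : XorRecurrence D M
    homogeneous k = trans (balanced⇒recurrence s α eqs (suc k))
                          (trans (cong ((D (1 + toℕ k) xor D (toℕ k)) xor_) (sₖ k)) (xor-identityʳ _))
    D₁ : D 1 ≡ true
    D₁ = trans (balanced⇒recurrence s α eqs zero)
               (trans (cong (_xor s zero) (xor-same (α zero))) s₀)
    solution : ∀ t → t ≤ suc M → D t ≡ per3 (D 0) true t
    solution t t≤ = trans (xorRecurrence⇒per3 M D homogeneous t t≤) (cong (λ b → per3 (D 0) b t) D₁)
    clash : per3 (D 0) true (suc M) ≡ per3 (D 0) true M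
    clash = trans (sym (solution (suc M) ≤-refl))
                  (trans (cong α (clamp-top M)) (solution M (m≤n⇒m≤1+n ≤-refl)))

pattern-balanced : ∀ {M} (s : Fin (suc M) → Bool) → (∀ k → s k ≡ false) → suc M % 3 ≡ 0 →
  IntersectionEqs s pattern101
pattern-balanced {M} s positive M+1≡0 k = begin
  per3 true true (suc (toℕ k))                              ≡⟨ per3-middle (toℕ k) ⟩
  per3 true true (toℕ k) xor per3 true true (2 + toℕ k)     ≡⟨ cong₂ _xor_ (pattern-down k) (pattern-up k) ⟨
  pattern101 (down k) xor pattern101 (up k)                 ≡⟨ cong (λ b → (b xor pattern101 (down k)) xor pattern101 (up k)) (positive k) ⟨
  (s k xor pattern101 (down k)) xor pattern101 (up k)       ∎
  where
    open ≡-Reasoning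
    pattern-down : ∀ {m} (k : Fin (suc m)) → pattern101 (down k) ≡ per3 true true (toℕ k)
    pattern-down zero = refl
    pattern-down (suc k) = cong (λ t → per3 true true (suc t)) (toℕ-inject₁ k)
    pattern-up : ∀ k → pattern101 (up k) ≡ per3 true true (2 + toℕ k)
    pattern-up k with lastView k
    ... | inner k′ = cong (λ t → per3 true true (suc t))
                          (trans (cong toℕ (up-inject₁ k′)) (cong suc (sym (toℕ-inject₁ k′))))
    ... | last = trans (cong (λ t → per3 true true (suc t)) (trans (cong toℕ (up-last M)) (toℕ-fromℕ M)))
                       (trans (Equivalence.from (per3-plateau M) M+1≡0)
                              (cong (λ t → per3 true true (2 + t)) (sym (toℕ-fromℕ M))))

linked-join : ∀ {A : Set} {R : A → A → Set} {x y z : A} {xs ys r} →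
  Linked R (x ∷ xs) → x ∷ xs ≡ r ∷ʳ z → R z y → Linked R (y ∷ ys) → Linked R (x ∷ xs ++ y ∷ ys)
linked-join {xs = []} {r = []} _ refl Rzy chain = Rzy ∷ chain
linked-join {xs = []} {r = _ ∷ []} _ () _ _
linked-join {xs = []} {r = _ ∷ _ ∷ _} _ () _ _
linked-join {xs = _ ∷ _} {r = []} _ () _ _
linked-join {xs = _ ∷ _} {r = _ ∷ r} (Rxw ∷ chain₁) ends Rzy chain₂ =
  Rxw ∷ linked-join chain₁ (∷-injectiveʳ ends) Rzy chain₂

module Geometry {n M : ℕ} (C : Chain n (suc M)) where
  open Chain C

  Int : Fin n → Set
  Int = IsIntersection C

  decInt : ∀ i → Dec (Int i)
  decInt i = any? (λ k → o k ≟ᶠ i)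

  Place : Set
  Place = Σ (Fin (suc (suc M))) λ K → Fin (suc (size K))

  at : Place → Fin n
  at (K , p) = cyc K p

  ℓ : (k : Fin (suc M)) → Fin (suc (size (suc k)))
  ℓ k = proj₁ (o-onNext k)

  ℓ-spec : ∀ k → cyc (suc k) (ℓ k) ≡ o k
  ℓ-spec k = proj₂ (o-onNext k)

  ℓ≤last : ∀ k → toℕ (ℓ k) ≤ toℕ (fromℕ (size (suc k)))
  ℓ≤last k = subst (toℕ (ℓ k) ≤_) (sym (toℕ-fromℕ _)) (toℕ≤pred[n] (ℓ k))

  adjacent : ∀ {K K′ p p′} → cyc K p ≡ cyc K′ p′ → toℕ K ≤ suc (toℕ K′)
  adjacent {K} {K′} {p} {p′} e = ≮⇒≥ (λ far → nonConsecutive K′ K p′ p far (sym e))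

  shared⇒intersection : ∀ {K K′ p p′} → toℕ K < toℕ K′ → cyc K p ≡ cyc K′ p′ → Int (cyc K p)
  shared⇒intersection {K′ = zero} ()
  shared⇒intersection {K} {suc k} {p} {p′} (s≤s K≤k) e
    with toℕ-injective {i = K} {j = inject₁ k}
           (trans (≤-antisym K≤k (s≤s⁻¹ (adjacent (sym e)))) (sym (toℕ-inject₁ k)))
  ... | refl = k , sym (consecutive k p p′ e)

  nonInt-place : ∀ {P Q} → ¬ Int (at P) → at P ≡ at Q → P ≡ Q
  nonInt-place {K , p} {K′ , p′} ni e with <-cmp (toℕ K) (toℕ K′)
  ... | tri< K<K′ _ _ = ⊥-elim (ni (shared⇒intersection K<K′ e))
  ... | tri> _ _ K′<K = ⊥-elim (ni (subst Int (sym e) (shared⇒intersection K′<K (sym e))))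
  ... | tri≈ _ K≡K′ _ with toℕ-injective K≡K′
  ...   | refl = cong (K ,_) (cyc-simple K e)

  intersectionAt : ∀ {K p} k → cyc K p ≡ o k →
    (K ≡ inject₁ k × toℕ p ≡ 0) ⊎ (K ≡ suc k × toℕ p ≡ toℕ (ℓ k))
  intersectionAt {K} {p} k e with m≤n⇒m<n∨m≡n (subst (λ t → toℕ K ≤ suc t) (toℕ-inject₁ k) (adjacent e))
  ... | inj₁ (s≤s K≤k) with toℕ-injective {i = K} {j = inject₁ k}
                              (trans (≤-antisym K≤k k≤K) (sym (toℕ-inject₁ k)))
    where
      k≤K : toℕ k ≤ toℕ K
      k≤K = s≤s⁻¹ (adjacent (trans (ℓ-spec k) (sym e)))
  ...   | refl = inj₁ (refl , cong toℕ (cyc-simple (inject₁ k) e))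
  intersectionAt {K} {p} k e | inj₂ K≡k+1 with toℕ-injective {i = K} {j = suc k} K≡k+1
  ... | refl = inj₂ (refl , cong toℕ (cyc-simple (suc k) (trans e (sym (ℓ-spec k)))))

  nonInt-C₀ : ∀ p → 0 < toℕ p → ¬ Int (cyc zero p)
  nonInt-C₀ p 0<p (k , e) with intersectionAt k (sym e)
  ... | inj₁ (_ , p≡0) = <⇒≢ 0<p (sym p≡0)
  ... | inj₂ (() , _)

  nonInt-Cₖ₊₁ : ∀ k p → toℕ p ≢ toℕ (ℓ k) → 0 < toℕ p ⊎ k ≡ fromℕ M → ¬ Int (cyc (suc k) p)
  nonInt-Cₖ₊₁ k p p≢ℓ side (k′ , e) with intersectionAt k′ (sym e) | side
  ... | inj₂ (refl , p≡ℓ) | _ = p≢ℓ p≡ℓ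
  ... | inj₁ (_ , p≡0) | inj₁ 0<p = <⇒≢ 0<p (sym p≡0)
  ... | inj₁ (last≡ , _) | inj₂ refl = fromℕ≢inject₁ last≡

  -- On a cycle C_{k+1} other than the last, position 0 holds o_{k+1}, so o_k is elsewhere.
  ℓ-nonzero : ∀ k → 0 < toℕ (ℓ (inject₁ k))
  ℓ-nonzero k = n≢0⇒n>0 (λ ℓ≡0 → 1+n≢n (trans (cong toℕ (o-distinct (same ℓ≡0))) (toℕ-inject₁ k)))
    where
      same : toℕ (ℓ (inject₁ k)) ≡ 0 → o (suc k) ≡ o (inject₁ k)
      same ℓ≡0 = trans (cong (cyc (suc (inject₁ k))) (sym (toℕ-injective {j = zero} ℓ≡0))) (ℓ-spec (inject₁ k))

  ℓ-zero⇒last : ∀ k → toℕ (ℓ k) ≡ 0 → up k ≡ k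
  ℓ-zero⇒last k ℓ≡0 with lastView k
  ... | inner k′ = ⊥-elim (<⇒≢ (ℓ-nonzero k′) (sym ℓ≡0))
  ... | last = up-last M

  UI : Fin n → Fin n → Set
  UI = UniqueInfluencer C

  predecessor-influences : ∀ K j → ¬ Int (cyc K j) → UI (cyc K (prevIx j)) (cyc K j)
  predecessor-influences K j ni = (K , j , refl , refl) , only-predecessor
    where
      only-predecessor : ∀ a → Arc C a (cyc K j) → a ≡ cyc K (prevIx j)
      only-predecessor a (K′ , j′ , refl , e) with nonInt-place {K , j} {K′ , j′} ni (sym e)
      ... | refl = refl

  -- The two predecessors of o_k are distinct unless both are o_k itself (consecutive cycles
  -- meet only in o_k), so o_k can only be uniquely influenced by itself.
  intersection-influencer : ∀ k a → UI a (o k) → a ≡ o k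
  intersection-influencer k a (_ , only) = trans (sym pred₁≡a) (consecutive k (prevIx zero) (prevIx (ℓ k)) (trans pred₁≡a (sym pred₂≡a)))
    where
      pred₁≡a : cyc (inject₁ k) (prevIx zero) ≡ a
      pred₁≡a = only _ (inject₁ k , zero , refl , refl)
      pred₂≡a : cyc (suc k) (prevIx (ℓ k)) ≡ a
      pred₂≡a = only _ (suc k , ℓ k , refl , ℓ-spec k)

  NudePathTo : Fin n → Fin n → List (Fin n) → Set
  NudePathTo i s q = NudePath C (s ∷ q) × ∃ λ r → s ∷ q ≡ r ∷ʳ i

  nude-maximal : ∀ {i s q} k → NudePathTo i s q → s ≡ o k → MaxIncomingNudeStart C i (o k)
  nude-maximal {q = q} k (nude , ends) refl = q , nude , ends , no-extension
    where
      no-extension : ∀ a → ¬ NudePath C (a ∷ o k ∷ q)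
      no-extension a ((a∉ ∷ _) , (a↝o ∷ _)) = All.head a∉ (intersection-influencer k a a↝o)

  Between : ∀ K → (a b : Fin (suc (size K))) → Fin n → Set
  Between K a b z = ∃ λ p → z ≡ cyc K p × toℕ a ≤ toℕ p × toℕ p ≤ toℕ b

  record Run (K : Fin (suc (suc M))) (a b : Fin (suc (size K))) : Set where
    field
      rest : List (Fin n)
      path : NudePathTo (cyc K b) (cyc K a) rest
      between : All (Between K a b) (cyc K a ∷ rest)

  stay : ∀ K a → Run K a a
  stay K a = record { rest = [] ; path = (([] ∷ []) , [-]) , ([] , refl) ; between = (a , refl , ≤-refl , ≤-refl) ∷ [] }

  join : ∀ {K a c d} (r₁ : Run K a (prevIx c)) (r₂ : Run K c d) → ¬ Int (cyc K c) →
    toℕ (prevIx c) < toℕ c ⊎ toℕ d < toℕ a →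
    NudePathTo (cyc K d) (cyc K a) (Run.rest r₁ ++ cyc K c ∷ Run.rest r₂)
  join {K} {a} {c} {d} r₁ r₂ ni order =
    ( unique-++⁺ (proj₁ (proj₁ R₁.path)) (proj₁ (proj₁ R₂.path)) disjoint
    , linked-join (proj₂ (proj₁ R₁.path)) (proj₂ (proj₂ R₁.path)) (predecessor-influences K c ni) (proj₂ (proj₁ R₂.path)) )
    , ((cyc K a ∷ R₁.rest) ++ proj₁ (proj₂ R₂.path))
    , trans (cong ((cyc K a ∷ R₁.rest) ++_) (proj₂ (proj₂ R₂.path)))
            (sym (++-assoc (cyc K a ∷ R₁.rest) (proj₁ (proj₂ R₂.path)) (cyc K d ∷ [])))
    where
      module R₁ = Run r₁
      module R₂ = Run r₂
      disjoint : Disjoint (cyc K a ∷ R₁.rest) (cyc K c ∷ R₂.rest)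
      disjoint (v∈₁ , v∈₂) with All.lookup R₁.between v∈₁ | All.lookup R₂.between v∈₂
      ... | p , refl , a≤p , p≤ | p′ , e , c≤p′ , p′≤d with cyc-simple K e
      ... | refl = [ (λ before → <-irrefl refl (≤-<-trans p≤ (<-≤-trans before c≤p′)))
                   , (λ after → <-irrefl refl (≤-<-trans p′≤d (<-≤-trans after a≤p))) ] order

  run-step : ∀ {K a} b → Run K a (inject₁ b) → toℕ a ≤ suc (toℕ b) → ¬ Int (cyc K (suc b)) → Run K a (suc b)
  run-step {K} {a} b r a≤ ni = record
    { rest = Run.rest r ∷ʳ cyc K (suc b)
    ; path = join r (stay K (suc b)) ni (inj₁ (s≤s (≤-reflexive (toℕ-inject₁ b))))
    ; between = all-++⁺ (All.map widen (Run.between r)) ((suc b , refl , a≤ , ≤-refl) ∷ [])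
    }
    where
      widen : ∀ {z} → Between K a (inject₁ b) z → Between K a (suc b) z
      widen (p , e , a≤p , p≤b) = p , e , a≤p , ≤-trans p≤b (≤-trans (≤-reflexive (toℕ-inject₁ b)) (n≤1+n _))

  Clear : ∀ K → (a b : Fin (suc (size K))) → Set
  Clear K a b = ∀ p → toℕ a < toℕ p → toℕ p ≤ toℕ b → ¬ Int (cyc K p)

  run : ∀ K (a b : Fin (suc (size K))) → toℕ a ≤ toℕ b → Clear K a b → Run K a b
  run K a b a≤b = run-by (toℕ b ∸ toℕ a) b (m∸n+n≡m a≤b)
    where
      run-by : ∀ d b → d + toℕ a ≡ toℕ b → Clear K a b → Run K a b
      run-by zero b a≡b clear with toℕ-injective {i = a} {j = b} a≡b
      ... | refl = stay K a
      run-by (suc d) zero () clear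
      run-by (suc d) (suc b) d+a≡b clear =
        run-step b (run-by d (inject₁ b) d+a≡b′ (λ p a<p p≤b → clear p a<p (≤-trans p≤b b′≤b)))
                 (<⇒≤ a<b) (clear (suc b) a<b ≤-refl)
        where
          d+a≡b′ : d + toℕ a ≡ toℕ (inject₁ b)
          d+a≡b′ = trans (suc-injective d+a≡b) (sym (toℕ-inject₁ b))
          b′≤b : toℕ (inject₁ b) ≤ suc (toℕ b)
          b′≤b = ≤-trans (≤-reflexive (toℕ-inject₁ b)) (n≤1+n _)
          a<b : toℕ a < suc (toℕ b)
          a<b = s≤s (subst (toℕ a ≤_) (suc-injective d+a≡b) (m≤n+m (toℕ a) d))

  run-maximal : ∀ {K a b} k → Run K a b → cyc K a ≡ o k → MaxIncomingNudeStart C (cyc K b) (o k)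
  run-maximal k r = nude-maximal k (Run.path r)

  -- The intersection automaton at which the maximal incoming nude path into a place starts:
  -- o₀ on C₀; on C_{k+1}, o_k from position ℓ k on, and before it o_{k+1} (o_k on the last cycle).
  home : Place → Fin (suc M)
  home (zero , p) = zero
  home (suc k , p) = if does (toℕ p <? toℕ (ℓ k)) then up k else k

  home-before : ∀ k p → toℕ p < toℕ (ℓ k) → home (suc k , p) ≡ up k
  home-before k p p<ℓ = cong (if_then up k else k) (dec-true (toℕ p <? toℕ (ℓ k)) p<ℓ)

  home-after : ∀ k p → toℕ (ℓ k) ≤ toℕ p → home (suc k , p) ≡ k
  home-after k p ℓ≤p = cong (if_then up k else k) (dec-false (toℕ p <? toℕ (ℓ k)) (λ p<ℓ → <⇒≱ p<ℓ ℓ≤p))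

  home-first : ∀ k → home (inject₁ k , zero) ≡ k
  home-first zero = refl
  home-first (suc k) = trans (home-before (inject₁ k) zero (ℓ-nonzero k)) (up-inject₁ k)

  home-at-intersection : ∀ {K p} k → cyc K p ≡ o k → home (K , p) ≡ k
  home-at-intersection {K} {p} k e with intersectionAt k e
  ... | inj₂ (refl , p≡ℓ) = home-after k p (≤-reflexive (sym p≡ℓ))
  ... | inj₁ (refl , p≡0) with toℕ-injective {i = p} {j = zero} p≡0
  ...   | refl = home-first k

  home-step : ∀ K j → ¬ Int (cyc K j) → home (K , j) ≡ home (K , prevIx j)
  home-step zero j ni = refl
  -- position 0 of C_{k+1} is not o_{k+1} only on the last cycle, where it descends from o_M
  home-step (suc k) zero ni with lastView k
  ... | inner k′ = ⊥-elim (ni (suc k′ , refl))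
  ... | last = trans (home-before (fromℕ M) zero 0<ℓ)
                     (trans (up-last M) (sym (home-after (fromℕ M) _ (ℓ≤last (fromℕ M)))))
    where
      0<ℓ : 0 < toℕ (ℓ (fromℕ M))
      0<ℓ = n≢0⇒n>0 (λ ℓ≡0 → ni (fromℕ M , sym (trans
              (cong (cyc (suc (fromℕ M))) (toℕ-injective {j = ℓ (fromℕ M)} (sym ℓ≡0)))
              (ℓ-spec (fromℕ M)))))
  home-step (suc k) (suc j) ni = by-side (toℕ (suc j) <? toℕ (ℓ k))
    where
      j≡ : toℕ (inject₁ j) ≡ toℕ j
      j≡ = toℕ-inject₁ j
      by-side : Dec (toℕ (suc j) < toℕ (ℓ k)) → home (suc k , suc j) ≡ home (suc k , inject₁ j)
      by-side (yes j+1<ℓ) = trans (home-before k (suc j) j+1<ℓ)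
        (sym (home-before k (inject₁ j) (subst (_< toℕ (ℓ k)) (sym j≡) (<-trans (n<1+n _) j+1<ℓ))))
      by-side (no j+1≮ℓ) = trans (home-after k (suc j) (<⇒≤ ℓ<j+1))
        (sym (home-after k (inject₁ j) (subst (toℕ (ℓ k) ≤_) (sym j≡) (s≤s⁻¹ ℓ<j+1))))
        where
          ℓ≢j+1 : toℕ (ℓ k) ≢ toℕ (suc j)
          ℓ≢j+1 ℓ≡ = ni (k , trans (sym (ℓ-spec k)) (cong (cyc (suc k)) (toℕ-injective ℓ≡)))
          ℓ<j+1 : toℕ (ℓ k) < suc (toℕ j)
          ℓ<j+1 = ≤∧≢⇒< (≮⇒≥ j+1≮ℓ) ℓ≢j+1

  home-pred₁ : ∀ k → home (inject₁ k , prevIx zero) ≡ down k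
  home-pred₁ zero = refl
  home-pred₁ (suc k) = home-after (inject₁ k) _ (ℓ≤last (inject₁ k))

  home-pred₂ : ∀ k → home (suc k , prevIx (ℓ k)) ≡ up k
  home-pred₂ k = at-position (ℓ k) refl
    where
      at-position : ∀ l → l ≡ ℓ k → home (suc k , prevIx l) ≡ up k
      at-position zero l≡ℓ = trans (home-after k _ (ℓ≤last k)) (sym (ℓ-zero⇒last k (cong toℕ (sym l≡ℓ))))
      at-position (suc l) l≡ℓ = home-before k (inject₁ l)
        (subst (λ m → toℕ (inject₁ l) < toℕ m) l≡ℓ (s≤s (≤-reflexive (toℕ-inject₁ l))))

  nude-from-own : ∀ k p → toℕ (ℓ k) ≤ toℕ p → MaxIncomingNudeStart C (cyc (suc k) p) (o k)
  nude-from-own k p ℓ≤p = run-maximal k (run (suc k) (ℓ k) p ℓ≤p clear) (ℓ-spec k)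
    where
      clear : Clear (suc k) (ℓ k) p
      clear q ℓ<q _ = nonInt-Cₖ₊₁ k q (>⇒≢ ℓ<q) (inj₁ (≤-<-trans z≤n ℓ<q))

  -- Before ℓ k the run starts at o_{k+1} at position 0, or on the last cycle wraps around from o_M.
  nude-from-next : ∀ k p → toℕ p < toℕ (ℓ k) → MaxIncomingNudeStart C (cyc (suc k) p) (o (up k))
  nude-from-next k p p<ℓ with lastView k
  ... | inner k′ rewrite up-inject₁ k′ = run-maximal (suc k′) (run (suc (inject₁ k′)) zero p z≤n clear) refl
    where
      clear : Clear (suc (inject₁ k′)) zero p
      clear q 0<q q≤p = nonInt-Cₖ₊₁ (inject₁ k′) q (<⇒≢ (≤-<-trans q≤p p<ℓ)) (inj₁ 0<q)
  ... | last rewrite up-last M = nude-maximal (fromℕ M) (join around from-start start-free (inj₂ p<ℓ)) (ℓ-spec (fromℕ M))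
    where
      K : Fin (suc (suc M))
      K = suc (fromℕ M)
      free : ∀ q → toℕ q ≢ toℕ (ℓ (fromℕ M)) → ¬ Int (cyc K q)
      free q q≢ℓ = nonInt-Cₖ₊₁ (fromℕ M) q q≢ℓ (inj₂ refl)
      around : Run K (ℓ (fromℕ M)) (fromℕ (size K))
      around = run K _ _ (ℓ≤last (fromℕ M)) (λ q ℓ<q _ → free q (>⇒≢ ℓ<q))
      from-start : Run K zero p
      from-start = run K zero p z≤n (λ q _ q≤p → free q (<⇒≢ (≤-<-trans q≤p p<ℓ)))
      start-free : ¬ Int (cyc K zero)
      start-free = free zero (<⇒≢ (≤-<-trans z≤n p<ℓ))

  home-nude : ∀ K p → MaxIncomingNudeStart C (cyc K p) (o (home (K , p)))
  home-nude zero p = run-maximal zero (run zero zero p z≤n (λ q 0<q _ → nonInt-C₀ q 0<q)) refl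
  home-nude (suc k) p = by-side (toℕ p <? toℕ (ℓ k))
    where
      by-side : Dec (toℕ p < toℕ (ℓ k)) → MaxIncomingNudeStart C (cyc (suc k) p) (o (home (suc k , p)))
      by-side (yes p<ℓ) = subst (λ h → MaxIncomingNudeStart C (cyc (suc k) p) (o h))
                                (sym (home-before k p p<ℓ)) (nude-from-next k p p<ℓ)
      by-side (no p≮ℓ) = subst (λ h → MaxIncomingNudeStart C (cyc (suc k) p) (o h))
                               (sym (home-after k p (≮⇒≥ p≮ℓ))) (nude-from-own k p (≮⇒≥ p≮ℓ))

  homeOf : Fin n → Fin (suc M)
  homeOf i = home (proj₁ (covered i) , proj₁ (proj₂ (covered i)))

  homeOf-at : ∀ K p → homeOf (cyc K p) ≡ home (K , p)
  homeOf-at K p with covered (cyc K p)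
  ... | K′ , p′ , e with decInt (cyc K p)
  ...   | yes (k , o≡) = trans (home-at-intersection k (trans e (sym o≡))) (sym (home-at-intersection k (sym o≡)))
  ...   | no ni with nonInt-place {K , p} {K′ , p′} ni (sym e)
  ...     | refl = refl

  homeOf-o : ∀ k → homeOf (o k) ≡ k
  homeOf-o k = trans (homeOf-at (inject₁ k) zero) (home-first k)

  homeOf-nude : ∀ i → MaxIncomingNudeStart C i (o (homeOf i))
  homeOf-nude i with covered i
  ... | K , p , refl = home-nude K p

module FixedPoints {n M : ℕ} (C : Chain n (suc M)) (sg : Signs C)
  (F : (Fin n → Bool) → Fin n → Bool) (net : IsChainNetwork C sg F)
  (copy-positive : ∀ K j → ¬ IsIntersection C (Chain.cyc C K j) → sg K j ≡ false)
  (second-positive : ∀ k l → sg (suc k) l ≡ false) where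
  open Chain C
  open Geometry C

  s : Fin (suc M) → Bool
  s k = sg (inject₁ k) zero

  pred₁ pred₂ : Fin (suc M) → Fin n
  pred₁ k = cyc (inject₁ k) (prevIx zero)
  pred₂ k = cyc (suc k) (prevIx (ℓ k))

  Copies : (Fin n → Bool) → Set
  Copies x = ∀ K j → ¬ Int (cyc K j) → x (cyc K j) ≡ x (cyc K (prevIx j))

  Balanced : (Fin n → Bool) → Set
  Balanced x = ∀ k → x (o k) ≡ (s k xor x (pred₁ k)) xor x (pred₂ k)

  fixed⇒copies : ∀ {x} → FixedPoint F x → Copies x
  fixed⇒copies {x} fp K j ni =
    trans (sym (fp (cyc K j))) (trans (proj₁ net x K j ni) (cong (λ b → lit C b (x (cyc K (prevIx j)))) (copy-positive K j ni)))

  fixed⇒balanced : ∀ {x} → FixedPoint F x → Balanced x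
  fixed⇒balanced {x} fp k =
    trans (sym (fp (o k))) (trans (proj₂ net x k (ℓ k) (ℓ-spec k))
      (cong (λ b → lit C (s k) (x (pred₁ k)) xor lit C b (x (pred₂ k))) (second-positive k (ℓ k))))

  local⇒fixed : ∀ {x} → Copies x → Balanced x → FixedPoint F x
  local⇒fixed {x} copies balanced i with covered i
  ... | K , j , refl with decInt (cyc K j)
  ...   | yes (k , e) = subst (λ z → F x z ≡ x z) e (trans (proj₂ net x k (ℓ k) (ℓ-spec k))
          (trans (cong (λ b → lit C (s k) (x (pred₁ k)) xor lit C b (x (pred₂ k))) (second-positive k (ℓ k)))
                 (sym (balanced k))))
  ...   | no ni = trans (proj₁ net x K j ni)
          (trans (cong (λ b → lit C b (x (cyc K (prevIx j)))) (copy-positive K j ni)) (sym (copies K j ni)))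

  copies-influence : ∀ {x a b} → Copies x → UI a b → a ≢ b → x b ≡ x a
  copies-influence {x} {a} {b} copies a↝b a≢b with covered b
  ... | K , j , refl with decInt (cyc K j)
  ...   | yes (k , e) = ⊥-elim (a≢b (trans (intersection-influencer k a (subst (UI a) (sym e) a↝b)) e))
  ...   | no ni = trans (copies K j ni) (cong x (proj₂ a↝b _ (K , j , refl , refl)))

  copies-nude : ∀ {x} → Copies x → ∀ {a q} → NudePath C (a ∷ q) → All (λ z → x z ≡ x a) (a ∷ q)
  copies-nude copies {q = []} _ = refl ∷ []
  copies-nude copies {q = b ∷ q} ((a∉ ∷ unique) , (a↝b ∷ linked)) =
    refl ∷ All.map (λ e → trans e (copies-influence copies a↝b (All.head a∉))) (copies-nude copies (unique , linked))

  copies-maxNude : ∀ {x i a} → Copies x → MaxIncomingNudeStart C i a → x i ≡ x a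
  copies-maxNude {i = i} copies (q , nude , (r , ends) , _) =
    All.lookup (copies-nude copies nude) (subst (i ∈_) (sym ends) (∈-++⁺ʳ r (here refl)))

  fixed⇒factors : ∀ {x} → FixedPoint F x → (∀ i → x i ≡ x (o (homeOf i))) × IntersectionEqs s (x ∘ o)
  fixed⇒factors {x} fp = factors , balanced
    where
      factors : ∀ i → x i ≡ x (o (homeOf i))
      factors i = copies-maxNude (fixed⇒copies fp) (homeOf-nude i)
      at-home : ∀ K p h → home (K , p) ≡ h → x (cyc K p) ≡ x (o h)
      at-home K p h home≡h = trans (factors (cyc K p)) (cong (x ∘ o) (trans (homeOf-at K p) home≡h))
      balanced : IntersectionEqs s (x ∘ o)
      balanced k = trans (fixed⇒balanced fp k)
        (cong₂ (λ u v → (s k xor u) xor v) (at-home _ _ _ (home-pred₁ k)) (at-home _ _ _ (home-pred₂ k)))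

  factors⇒fixed : ∀ x α → (∀ i → x i ≡ α (homeOf i)) → IntersectionEqs s α → FixedPoint F x
  factors⇒fixed x α factors eqs = local⇒fixed copies balanced
    where
      at-place : ∀ K p → x (cyc K p) ≡ α (home (K , p))
      at-place K p = trans (factors (cyc K p)) (cong α (homeOf-at K p))
      copies : Copies x
      copies K j ni = trans (at-place K j) (trans (cong α (home-step K j ni)) (sym (at-place K (prevIx j))))
      balanced : Balanced x
      balanced k = begin
        x (o k)                                           ≡⟨ trans (factors (o k)) (cong α (homeOf-o k)) ⟩
        α k                                               ≡⟨ eqs k ⟩
        (s k xor α (down k)) xor α (up k)                 ≡⟨ cong₂ (λ u v → (s k xor α u) xor α v) (home-pred₁ k) (home-pred₂ k) ⟨
        (s k xor α (home (inject₁ k , prevIx zero))) xor α (home (suc k , prevIx (ℓ k)))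
                                                          ≡⟨ cong₂ (λ u v → (s k xor u) xor v) (at-place _ _) (at-place _ _) ⟨
        (s k xor x (pred₁ k)) xor x (pred₂ k)             ∎
        where open ≡-Reasoning

module PositiveChain {n M : ℕ} (C : Chain n (suc M)) (sg : Signs C)
  (F : (Fin n → Bool) → Fin n → Bool) (net : IsChainNetwork C sg F) (positive : Positive C sg) where
  open Chain C
  open Geometry C
  open FixedPoints C sg F net (λ K j _ → positive K j) (λ k l → positive (suc k) l)

  s-false : ∀ k → s k ≡ false
  s-false k = positive (inject₁ k) zero

  pat101≡pattern : ∀ t → pat101 C t ≡ per3 true true (suc t)
  pat101≡pattern zero = refl
  pat101≡pattern (suc zero) = refl
  pat101≡pattern (suc (suc zero)) = refl
  pat101≡pattern (suc (suc (suc t))) = pat101≡pattern t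

  classify : ∀ x → FixedPoint F x → IsZero x ⊎ (Special C x × suc M % 3 ≡ 0)
  classify x fp = by-start (x (o zero)) refl
    where
      factors : ∀ i → x i ≡ x (o (homeOf i))
      factors = proj₁ (fixed⇒factors fp)
      solved : (∀ k → x (o k) ≡ per3 (x (o zero)) (x (o zero)) (suc (toℕ k))) × (x (o zero) ≡ true → suc M % 3 ≡ 0)
      solved = positive-balanced s (x ∘ o) s-false (proj₂ (fixed⇒factors fp))
      values : ∀ {b} → x (o zero) ≡ b → ∀ k → x (o k) ≡ per3 b b (suc (toℕ k))
      values start k = trans (proj₁ solved k) (cong (λ c → per3 c c (suc (toℕ k))) start)
      by-start : ∀ b → x (o zero) ≡ b → IsZero x ⊎ (Special C x × suc M % 3 ≡ 0)
      by-start false start = inj₁ (λ i → trans (factors i) (trans (values start (homeOf i)) (per3-false (suc (toℕ (homeOf i))))))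
      by-start true start = inj₂ ( ( (λ k → trans (values start k) (sym (pat101≡pattern (toℕ k))))
                                   , (λ i a _ max → copies-maxNude (fixed⇒copies fp) max) )
                                 , proj₂ solved start )

  zero-fixed : ∀ x → IsZero x → FixedPoint F x
  zero-fixed x x≡0 = factors⇒fixed x (λ _ → false) x≡0 (λ k → cong (λ b → (b xor false) xor false) (sym (s-false k)))

  special-factors : ∀ x → Special C x → ∀ i → x i ≡ pattern101 (homeOf i)
  special-factors x (o-values , nude-values) i with decInt i
  ... | yes (k , refl) = trans (o-values k) (trans (pat101≡pattern (toℕ k)) (cong pattern101 (sym (homeOf-o k))))
  ... | no ni = trans (nude-values i _ ni (homeOf-nude i)) (trans (o-values (homeOf i)) (pat101≡pattern (toℕ (homeOf i))))

  special-fixed : suc M % 3 ≡ 0 → ∀ x → Special C x → FixedPoint F x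
  special-fixed 3∣m′ x special =
    factors⇒fixed x pattern101 (special-factors x special) (pattern-balanced s s-false 3∣m′)

  special-exists : suc M % 3 ≡ 0 → ∃ λ y → Special C y
  special-exists 3∣m′ = y , (λ k → trans (cong pattern101 (homeOf-o k)) (sym (pat101≡pattern (toℕ k))))
                          , (λ i a _ max → copies-maxNude (fixed⇒copies y-fixed) max)
    where
      y : Fin n → Bool
      y i = pattern101 (homeOf i)
      y-fixed : FixedPoint F y
      y-fixed = factors⇒fixed y pattern101 (λ _ → refl) (pattern-balanced s s-false 3∣m′)

negative-noFixedPoint : ∀ {n M} (C : Chain n (suc M)) (sg : Signs C) (F : (Fin n → Bool) → Fin n → Bool) →
  IsChainNetwork C sg F → Negative C sg → suc (suc M) % 3 ≡ 1 → ∀ x → ¬ FixedPoint F x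
negative-noFixedPoint C sg F net negative M≡2 x fp =
  negative-balanced s (x ∘ o) (negative zero zero) (λ k → negative (suc (inject₁ k)) zero) M≡2
                    (proj₂ (fixed⇒factors fp))
  where
    open Chain C
    -- the only negated literal belongs to the intersection automaton o₀
    copy-positive : ∀ K j → ¬ IsIntersection C (cyc K j) → sg K j ≡ false
    copy-positive zero zero ni = ⊥-elim (ni (zero , refl))
    copy-positive zero (suc j) _ = negative zero (suc j)
    copy-positive (suc K) j _ = negative (suc K) j
    open FixedPoints C sg F net copy-positive (λ k l → negative (suc k) l)

proposition5 : ∀ {n m' : ℕ} → 1 ≤ m' → (C : Chain n m') (sg : Signs C)
    (F : (Fin n → Bool) → Fin n → Bool) → IsChainNetwork C sg F →
    (Positive C sg →
      (m' % 3 ≢ 0 → ∀ x → FixedPoint F x ⇔ IsZero x)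
      × (m' % 3 ≡ 0 → (∃ λ y → Special C y)
          × (∀ x → FixedPoint F x ⇔ (IsZero x ⊎ Special C x))))
    × (Negative C sg → suc m' % 3 ≡ 1 → ∀ x → ¬ FixedPoint F x)
proposition5 {m' = suc M} _ C sg F net = positive , negative-noFixedPoint C sg F net
  where
    positive : Positive C sg →
      (suc M % 3 ≢ 0 → ∀ x → FixedPoint F x ⇔ IsZero x)
      × (suc M % 3 ≡ 0 → (∃ λ y → Special C y) × (∀ x → FixedPoint F x ⇔ (IsZero x ⊎ Special C x)))
    positive pos =
        (λ 3∤m′ x → mk⇔ (λ fp → [ id , (λ special → ⊥-elim (3∤m′ (proj₂ special))) ] (classify x fp))
                        (zero-fixed x))
      , (λ 3∣m′ → special-exists 3∣m′
                , λ x → mk⇔ (λ fp → map₂ proj₁ (classify x fp)) [ zero-fixed x , special-fixed 3∣m′ x ])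
      where open PositiveChain C sg F net pos
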